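{- For every $(k,k)$-Dyck path $\pi$, $\mathrm{dinv}(\pi)=\mathrm{maxtdinv}(\pi)$.
   Context: A $(k,k)$-Dyck path is a path of unit north and east steps from $(0,0)$ to $(k,k)$ staying weakly above the diagonal. Let $s_-=1-\epsilon$ for small $\epsilon>0$. $\mathrm{dinv}(\pi)$ is the number of pairs $(e,f)$ with $e$ an east step and $f$ a north step of $\pi$ such that $e$ is to the left of $f$ and some line of slope $s_-$ intersects both $e$ and $f$. The sweeping order orders the north steps of $\pi$ by the distance of their southern endpoints from the line $y=s_-x$; a north step $z$ attacks every north step of $\pi$ that is greater than $z$ in this order but smaller than the unit north step directly above $z$ (which need not be a step of $\pi$). $\mathrm{maxtdinv}(\pi)$ is the number of attacking pairs of north steps of $\pi$. -}

module Defs where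

open import Data.Bool using (Bool; true; false; _∧_; _∨_; if_then_else_)
open import Data.Nat as ℕ using (ℕ; zero; suc)
open import Data.Integer as ℤ using (ℤ; +_; _-_)
open import Data.Product using (_×_; _,_)
open import Data.List using (List; []; _∷_; length; filter; map; concatMap)
open import Data.List.Relation.Unary.All using (All)
open import Relation.Binary.PropositionalEquality using (_≡_)
open import Relation.Nullary.Decidable using (⌊_⌋)

data Step : Set where
  N E : Step

Point : Set
Point = ℕ × ℕ

-- The steps of a path starting at (x , y), each paired with its
-- starting point (southern endpoint of a north step, western endpoint
-- of an east step).
stepsFrom : Point → List Step → List (Step × Point)
stepsFrom p [] = []
stepsFrom (x , y) (N ∷ s) = (N , (x , y)) ∷ stepsFrom (x , suc y) s
stepsFrom (x , y) (E ∷ s) = (E , (x , y)) ∷ stepsFrom (suc x , y) s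

endFrom : Point → List Step → Point
endFrom p [] = p
endFrom (x , y) (N ∷ s) = endFrom (x , suc y) s
endFrom (x , y) (E ∷ s) = endFrom (suc x , y) s

vertices : List Step → List Point
vertices s = map (λ { (_ , p) → p }) (stepsFrom (0 , 0) s) Data.List.++ (endFrom (0 , 0) s ∷ [])

-- A (k,k)-Dyck path: a path of unit N and E steps from (0,0) to (k,k)
-- staying weakly above the diagonal y = x (every vertex satisfies x ≤ y;
-- as the path is piecewise linear, this is the same as the whole path
-- staying weakly above the diagonal).
record IsDyck (k : ℕ) (π : List Step) : Set where
  field
    ends  : endFrom (0 , 0) π ≡ (k , k)
    above : All (λ { (x , y) → x ℕ.≤ y }) (vertices π)

eastSteps : List Step → List Point
eastSteps π = concatMap (λ { (N , p) → [] ; (E , p) → p ∷ [] }) (stepsFrom (0 , 0) π)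

northSteps : List Step → List Point
northSteps π = concatMap (λ { (N , p) → p ∷ [] ; (E , p) → [] }) (stepsFrom (0 , 0) π)

-- Arithmetic with an infinitesimal ε > 0: the pair (a , b) stands for
-- a + b·ε, ordered lexicographically (this is exactly the order of the
-- real numbers a + b·ε for all sufficiently small ε > 0).

Zε : Set
Zε = ℤ × ℤ

ι : ℤ → Zε
ι a = a , + 0

_-ε_ : Zε → Zε → Zε
(a , b) -ε (c , d) = (a - c) , (b - d)

_≤ε_ : Zε → Zε → Bool
(a , b) ≤ε (c , d) = ⌊ a ℤ.<? c ⌋ ∨ (⌊ a ℤ.≟ c ⌋ ∧ ⌊ b ℤ.≤? d ⌋)

_<ε_ : Zε → Zε → Bool
(a , b) <ε (c , d) = ⌊ a ℤ.<? c ⌋ ∨ (⌊ a ℤ.≟ c ⌋ ∧ ⌊ b ℤ.<? d ⌋)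

-- The slope s₋ = 1 - ε, and s₋ · x for an integer x.
s₋· : ℤ → Zε
s₋· x = x , (ℤ.- x)

count : {A : Set} → (A → Bool) → List A → ℕ
count P xs = length (filter (λ a → Data.Bool.T? (P a)) xs)

pairs : {A B : Set} → List A → List B → List (A × B)
pairs xs ys = concatMap (λ a → map (λ b → a , b) ys) xs

-- The lines of slope s₋ are y = s₋ x + t. Such a line meets the closed
-- east step from (a,b) to (a+1,b) iff  b - s₋(a+1) ≤ t ≤ b - s₋ a,
-- and meets the closed north step from (c,d) to (c,d+1) iff
-- d - s₋ c ≤ t ≤ d + 1 - s₋ c.  Some line meets both iff these two
-- closed intercept intervals overlap.
someLineMeets : Point → Point → Bool
someLineMeets (a , b) (c , d) =
  (lo₁ ≤ε hi₂) ∧ (lo₂ ≤ε hi₁)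
  where
    lo₁ = ι (+ b) -ε s₋· (+ suc a)
    hi₁ = ι (+ b) -ε s₋· (+ a)
    lo₂ = ι (+ d) -ε s₋· (+ c)
    hi₂ = ι (+ suc d) -ε s₋· (+ c)

-- East step e (from (a,b)) is to the left of north step f (at x = c)
-- iff a + 1 ≤ c.
dinvPair : Point × Point → Bool
dinvPair ((a , b) , (c , d)) = (suc a ℕ.≤ᵇ c) ∧ someLineMeets (a , b) (c , d)

dinv : List Step → ℕ
dinv π = count dinvPair (pairs (eastSteps π) (northSteps π))

-- (Signed, unnormalised) distance of the point (x,y) from the line
-- y = s₋ x, namely y - s₋ x; the actual Euclidean distance is this
-- quantity divided by the positive constant √(1 + s₋²), so it induces
-- the same order.
dist : Point → Zε
dist (x , y) = ι (+ y) -ε s₋· (+ x)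

attacks : Point × Point → Bool
attacks ((x , y) , q) = (dist (x , y) <ε dist q) ∧ (dist q <ε dist (x , suc y))

maxtdinv : List Step → ℕ
maxtdinv π = count attacks (pairs (northSteps π) (northSteps π))

-- Build the path one step at a time.  An east step creates no new pair: it
-- lies to the right of every earlier north step.  Write level (x , y) = y − x.
-- A north step f starting at level v forms a dinv pair with exactly the
-- earlier east steps ending at level v or v + 1, and an attacking pair with
-- exactly the earlier north steps starting at level v or v + 1 (those below f
-- in its own column are at a lower level and attack nothing).  Along any path
-- above the diagonal, the north steps starting at level w outnumber the east
-- steps ending at level w by one if the path ends above w, and by zero
-- otherwise; the path up to f ends at level v, so both counts agree.

module Submission where

open import Defs
open import Data.Bool using (Bool; true; false; _∧_; _∨_; T?)
open import Data.Nat using (ℕ; zero; suc; _+_; _∸_; _≤_; _<_; z≤n; s≤s; _<ᵇ_; _≤ᵇ_; _≡ᵇ_)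
import Data.Nat.Properties as ℕ
open import Data.Nat.Solver using (module +-*-Solver)
open +-*-Solver using (solve; _:+_; con; _:=_)
open import Algebra.Properties.CommutativeSemigroup ℕ.+-commutativeSemigroup using (interchange)
import Data.Integer as ℤ
import Data.Integer.Properties as ℤ
open import Data.Product using (_×_; _,_; proj₁; proj₂; map₂)
open import Data.Sum using (_⊎_; inj₁; inj₂)
open import Data.List using (List; []; _∷_; _++_; _∷ʳ_; [_]; map; filter; length; concatMap)
import Data.List.Properties as List
open import Data.List.Relation.Unary.All as All using (All; []; _∷_)
import Data.List.Relation.Unary.All.Properties as All
open import Data.List.Reverse using (Reverse; reverseView; []; _∶_∶ʳ_)
open import Function using (_∘_)
open import Relation.Binary.PropositionalEquality
  using (_≡_; refl; sym; trans; cong; cong₂; subst; module ≡-Reasoning)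
open import Relation.Nullary.Decidable using (isYes≗does)

open ≡-Reasoning

𝟙 : Bool → ℕ
𝟙 true  = 1
𝟙 false = 0

private variable A B : Set

count-∷ : (P : A → Bool) (x : A) (xs : List A) → count P (x ∷ xs) ≡ 𝟙 (P x) + count P xs
count-∷ P x xs with P x
... | true  = refl
... | false = refl

count-++ : (P : A → Bool) (xs ys : List A) → count P (xs ++ ys) ≡ count P xs + count P ys
count-++ P xs ys = trans (cong length (List.filter-++ (T? ∘ P) xs ys)) (List.length-++ (filter (T? ∘ P) xs))

count-∷ʳ : (P : A → Bool) (xs : List A) (x : A) → count P (xs ∷ʳ x) ≡ count P xs + 𝟙 (P x)
count-∷ʳ P xs x = trans (count-++ P xs [ x ]) (cong (count P xs +_) (trans (count-∷ P x []) (ℕ.+-identityʳ _)))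

count-map : (P : B → Bool) (f : A → B) (xs : List A) → count P (map f xs) ≡ count (P ∘ f) xs
count-map P f []       = refl
count-map P f (x ∷ xs) =
  trans (count-∷ P (f x) (map f xs)) (trans (cong (𝟙 (P (f x)) +_) (count-map P f xs)) (sym (count-∷ (P ∘ f) x xs)))

count-cong : {P Q : A → Bool} {xs : List A} → All (λ x → P x ≡ Q x) xs → count P xs ≡ count Q xs
count-cong {xs = []} [] = refl
count-cong {P = P} {Q} {x ∷ xs} (Px≡Qx ∷ rest) =
  trans (count-∷ P x xs) (trans (cong₂ _+_ (cong 𝟙 Px≡Qx) (count-cong rest)) (sym (count-∷ Q x xs)))

count-none : {P : A → Bool} {xs : List A} → All (λ x → P x ≡ false) xs → count P xs ≡ 0
count-none {xs = []} [] = refl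
count-none {P = P} {x ∷ xs} (Px≡false ∷ rest) =
  trans (count-∷ P x xs) (cong₂ _+_ (cong 𝟙 Px≡false) (count-none rest))

count-split : {P Q R : A → Bool} {xs : List A} → All (λ x → 𝟙 (P x) ≡ 𝟙 (Q x) + 𝟙 (R x)) xs →
              count P xs ≡ count Q xs + count R xs
count-split {xs = []} [] = refl
count-split {P = P} {Q} {R} {x ∷ xs} (split ∷ rest) = begin
  count P (x ∷ xs)                                        ≡⟨ count-∷ P x xs ⟩
  𝟙 (P x) + count P xs                                    ≡⟨ cong₂ _+_ split (count-split rest) ⟩
  (𝟙 (Q x) + 𝟙 (R x)) + (count Q xs + count R xs)         ≡⟨ interchange (𝟙 (Q x)) _ _ _ ⟩
  (𝟙 (Q x) + count Q xs) + (𝟙 (R x) + count R xs)         ≡⟨ sym (cong₂ _+_ (count-∷ Q x xs) (count-∷ R x xs)) ⟩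
  count Q (x ∷ xs) + count R (x ∷ xs)                     ∎

module _ (P : A × B → Bool) where

  count-pairs-∷ˡ : (x : A) (xs : List A) (ys : List B) →
                   count P (pairs (x ∷ xs) ys) ≡ count (λ y → P (x , y)) ys + count P (pairs xs ys)
  count-pairs-∷ˡ x xs ys =
    trans (count-++ P (map (x ,_) ys) (pairs xs ys)) (cong (_+ count P (pairs xs ys)) (count-map P (x ,_) ys))

  count-pairs-∷ʳˡ : (xs : List A) (x : A) (ys : List B) →
                    count P (pairs (xs ∷ʳ x) ys) ≡ count P (pairs xs ys) + count (λ y → P (x , y)) ys
  count-pairs-∷ʳˡ xs x ys = begin
    count P (pairs (xs ∷ʳ x) ys)                      ≡⟨ cong (count P) (List.concatMap-++ (λ a → map (a ,_) ys) xs [ x ]) ⟩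
    count P (pairs xs ys ++ pairs [ x ] ys)           ≡⟨ count-++ P (pairs xs ys) (pairs [ x ] ys) ⟩
    count P (pairs xs ys) + count P (pairs [ x ] ys)  ≡⟨ cong (count P (pairs xs ys) +_) (count-pairs-∷ˡ x [] ys) ⟩
    count P (pairs xs ys) + (count (λ y → P (x , y)) ys + 0) ≡⟨ cong (count P (pairs xs ys) +_) (ℕ.+-identityʳ _) ⟩
    count P (pairs xs ys) + count (λ y → P (x , y)) ys ∎

  count-pairs-∷ʳʳ : (xs : List A) (ys : List B) (y : B) →
                    count P (pairs xs (ys ∷ʳ y)) ≡ count P (pairs xs ys) + count (λ x → P (x , y)) xs
  count-pairs-∷ʳʳ []       ys y = refl
  count-pairs-∷ʳʳ (x ∷ xs) ys y = begin
    count P (pairs (x ∷ xs) (ys ∷ʳ y))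
      ≡⟨ count-pairs-∷ˡ x xs (ys ∷ʳ y) ⟩
    count (λ b → P (x , b)) (ys ∷ʳ y) + count P (pairs xs (ys ∷ʳ y))
      ≡⟨ cong₂ _+_ (count-∷ʳ (λ b → P (x , b)) ys y) (count-pairs-∷ʳʳ xs ys y) ⟩
    (count (λ b → P (x , b)) ys + 𝟙 (P (x , y))) + (count P (pairs xs ys) + count (λ a → P (a , y)) xs)
      ≡⟨ interchange (count (λ b → P (x , b)) ys) _ _ _ ⟩
    (count (λ b → P (x , b)) ys + count P (pairs xs ys)) + (𝟙 (P (x , y)) + count (λ a → P (a , y)) xs)
      ≡⟨ sym (cong₂ _+_ (count-pairs-∷ˡ x xs ys) (count-∷ (λ a → P (a , y)) x xs)) ⟩
    count P (pairs (x ∷ xs) ys) + count (λ a → P (a , y)) (x ∷ xs) ∎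

∷ʳ-induction : (P : List A → Set) → P [] → (∀ xs x → P xs → P (xs ∷ʳ x)) → ∀ xs → P xs
∷ʳ-induction P base step xs = go (reverseView xs)
  where
  go : ∀ {xs} → Reverse xs → P xs
  go []             = base
  go (xs ∶ r ∶ʳ x) = step xs x (go r)

step : Step → Point → Point
step N (x , y) = x , suc y
step E (x , y) = suc x , y

end : List Step → Point
end = endFrom (0 , 0)

endFrom-∷ʳ : ∀ p s t → endFrom p (s ∷ʳ t) ≡ step t (endFrom p s)
endFrom-∷ʳ p       []      N = refl
endFrom-∷ʳ p       []      E = refl
endFrom-∷ʳ (x , y) (N ∷ s) t = endFrom-∷ʳ (x , suc y) s t
endFrom-∷ʳ (x , y) (E ∷ s) t = endFrom-∷ʳ (suc x , y) s t

stepsFrom-∷ʳ : ∀ p s t → stepsFrom p (s ∷ʳ t) ≡ stepsFrom p s ∷ʳ (t , endFrom p s)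
stepsFrom-∷ʳ p       []      N = refl
stepsFrom-∷ʳ p       []      E = refl
stepsFrom-∷ʳ (x , y) (N ∷ s) t = cong ((N , (x , y)) ∷_) (stepsFrom-∷ʳ (x , suc y) s t)
stepsFrom-∷ʳ (x , y) (E ∷ s) t = cong ((E , (x , y)) ∷_) (stepsFrom-∷ʳ (suc x , y) s t)

end-∷ʳ : ∀ s t → end (s ∷ʳ t) ≡ step t (end s)
end-∷ʳ = endFrom-∷ʳ (0 , 0)

northSteps-∷ʳN : ∀ s → northSteps (s ∷ʳ N) ≡ northSteps s ∷ʳ end s
northSteps-∷ʳN s = trans (cong (concatMap _) (stepsFrom-∷ʳ (0 , 0) s N)) (List.concatMap-++ _ (stepsFrom (0 , 0) s) _)

northSteps-∷ʳE : ∀ s → northSteps (s ∷ʳ E) ≡ northSteps s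
northSteps-∷ʳE s = trans (cong (concatMap _) (stepsFrom-∷ʳ (0 , 0) s E))
  (trans (List.concatMap-++ _ (stepsFrom (0 , 0) s) _) (List.++-identityʳ _))

eastSteps-∷ʳN : ∀ s → eastSteps (s ∷ʳ N) ≡ eastSteps s
eastSteps-∷ʳN s = trans (cong (concatMap _) (stepsFrom-∷ʳ (0 , 0) s N))
  (trans (List.concatMap-++ _ (stepsFrom (0 , 0) s) _) (List.++-identityʳ _))

eastSteps-∷ʳE : ∀ s → eastSteps (s ∷ʳ E) ≡ eastSteps s ∷ʳ end s
eastSteps-∷ʳE s = trans (cong (concatMap _) (stepsFrom-∷ʳ (0 , 0) s E)) (List.concatMap-++ _ (stepsFrom (0 , 0) s) _)

vertices-∷ʳ : ∀ s t → vertices (s ∷ʳ t) ≡ vertices s ∷ʳ end (s ∷ʳ t)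
vertices-∷ʳ s t = trans (cong (λ l → map proj₂ l ∷ʳ end (s ∷ʳ t)) (stepsFrom-∷ʳ (0 , 0) s t))
                        (cong (_∷ʳ end (s ∷ʳ t)) (List.map-++ proj₂ (stepsFrom (0 , 0) s) _))

WeaklyAbove : Point → Set
WeaklyAbove (x , y) = x ≤ y

Above : List Step → Set
Above s = All WeaklyAbove (vertices s)

Above-∷ʳ⁻ : ∀ s t → Above (s ∷ʳ t) → Above s × WeaklyAbove (end (s ∷ʳ t))
Above-∷ʳ⁻ s t h = All.∷ʳ⁻ (subst (All WeaklyAbove) (vertices-∷ʳ s t) h)

Above-end : ∀ s → Above s → WeaklyAbove (end s)
Above-end s h = proj₂ (All.∷ʳ⁻ h)

-- q ≺ p: a north/east path visits q strictly before p.
_≺_ : Point → Point → Set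
(x′ , y′) ≺ (x , y) = x′ < x ⊎ (x′ ≡ x × y′ < y)

≺⇒≤ : ∀ {q p} → q ≺ p → proj₁ q ≤ proj₁ p
≺⇒≤ (inj₁ x′<x)        = ℕ.<⇒≤ x′<x
≺⇒≤ (inj₂ (refl , _)) = ℕ.≤-refl

≺-step : ∀ {q p} t → q ≺ p → q ≺ step t p
≺-step N (inj₁ x′<x)         = inj₁ x′<x
≺-step N (inj₂ (refl , y′<y)) = inj₂ (refl , ℕ.m<n⇒m<1+n y′<y)
≺-step E q≺p                 = inj₁ (s≤s (≺⇒≤ q≺p))

northSteps-above-≺end : ∀ s → Above s → All (λ q → WeaklyAbove q × q ≺ end s) (northSteps s)
northSteps-above-≺end = ∷ʳ-induction _ (λ _ → []) extend
  where
  extend : ∀ s t → (Above s → All (λ q → WeaklyAbove q × q ≺ end s) (northSteps s)) →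
           Above (s ∷ʳ t) → All (λ q → WeaklyAbove q × q ≺ end (s ∷ʳ t)) (northSteps (s ∷ʳ t))
  extend s t ih h with Above-∷ʳ⁻ s t h
  ... | above-s , _ rewrite end-∷ʳ s t with t
  ... | N rewrite northSteps-∷ʳN s =
    All.++⁺ (All.map (map₂ (≺-step N)) (ih above-s)) ((Above-end s above-s , inj₂ (refl , ℕ.n<1+n _)) ∷ [])
  ... | E rewrite northSteps-∷ʳE s = All.map (map₂ (≺-step E)) (ih above-s)

eastSteps-above-left : ∀ s → Above s →
  All (λ e → WeaklyAbove (step E e) × proj₁ e < proj₁ (end s)) (eastSteps s)
eastSteps-above-left = ∷ʳ-induction _ (λ _ → []) extend
  where
  extend : ∀ s t → (Above s → All (λ e → WeaklyAbove (step E e) × proj₁ e < proj₁ (end s)) (eastSteps s)) →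
           Above (s ∷ʳ t) → All (λ e → WeaklyAbove (step E e) × proj₁ e < proj₁ (end (s ∷ʳ t))) (eastSteps (s ∷ʳ t))
  extend s t ih h with Above-∷ʳ⁻ s t h
  ... | above-s , above-last rewrite end-∷ʳ s t with t
  ... | N rewrite eastSteps-∷ʳN s = ih above-s
  ... | E rewrite eastSteps-∷ʳE s =
    All.++⁺ (All.map (map₂ ℕ.m<n⇒m<1+n) (ih above-s)) ((above-last , ℕ.n<1+n _) ∷ [])

level : Point → ℕ
level (x , y) = y ∸ x

north-east-balance : ∀ s → Above s → ∀ w →
  count (λ q → level q ≡ᵇ w) (northSteps s) ≡ count (λ e → level (step E e) ≡ᵇ w) (eastSteps s) + 𝟙 (w <ᵇ level (end s))
north-east-balance = ∷ʳ-induction _ (λ _ _ → refl) extend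
  where
  𝟙-<ᵇ-suc : ∀ w h → 𝟙 (w <ᵇ suc h) ≡ 𝟙 (w <ᵇ h) + 𝟙 (h ≡ᵇ w)
  𝟙-<ᵇ-suc zero    zero    = refl
  𝟙-<ᵇ-suc zero    (suc h) = refl
  𝟙-<ᵇ-suc (suc w) zero    = refl
  𝟙-<ᵇ-suc (suc w) (suc h) = 𝟙-<ᵇ-suc w h

  Balanced : List Step → Set
  Balanced s = Above s → ∀ w →
    count (λ q → level q ≡ᵇ w) (northSteps s) ≡ count (λ e → level (step E e) ≡ᵇ w) (eastSteps s) + 𝟙 (w <ᵇ level (end s))

  extend : ∀ s t → Balanced s → Balanced (s ∷ʳ t)
  extend s t ih h w with Above-∷ʳ⁻ s t h
  ... | above-s , above-last rewrite end-∷ʳ s t with t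
  ... | N rewrite northSteps-∷ʳN s | eastSteps-∷ʳN s = begin
    count Lᴺ (northSteps s ∷ʳ end s)            ≡⟨ count-∷ʳ Lᴺ (northSteps s) (end s) ⟩
    count Lᴺ (northSteps s) + 𝟙 (h₀ ≡ᵇ w)       ≡⟨ cong (_+ 𝟙 (h₀ ≡ᵇ w)) (ih above-s w) ⟩
    count Lᴱ (eastSteps s) + 𝟙 (w <ᵇ h₀) + 𝟙 (h₀ ≡ᵇ w) ≡⟨ ℕ.+-assoc (count Lᴱ (eastSteps s)) _ _ ⟩
    count Lᴱ (eastSteps s) + (𝟙 (w <ᵇ h₀) + 𝟙 (h₀ ≡ᵇ w)) ≡⟨ cong (count Lᴱ (eastSteps s) +_) (sym (𝟙-<ᵇ-suc w h₀)) ⟩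
    count Lᴱ (eastSteps s) + 𝟙 (w <ᵇ suc h₀)    ≡⟨ cong (λ h → count Lᴱ (eastSteps s) + 𝟙 (w <ᵇ h)) (sym (ℕ.+-∸-assoc 1 (Above-end s above-s))) ⟩
    count Lᴱ (eastSteps s) + 𝟙 (w <ᵇ level (step N (end s))) ∎
    where
    Lᴺ = λ q → level q ≡ᵇ w
    Lᴱ = λ e → level (step E e) ≡ᵇ w
    h₀ = level (end s)
  ... | E rewrite northSteps-∷ʳE s | eastSteps-∷ʳE s = begin
    count Lᴺ (northSteps s)                          ≡⟨ ih above-s w ⟩
    count Lᴱ (eastSteps s) + 𝟙 (w <ᵇ level (end s))   ≡⟨ cong (λ h → count Lᴱ (eastSteps s) + 𝟙 (w <ᵇ h)) (ℕ.+-∸-assoc 1 above-last) ⟩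
    count Lᴱ (eastSteps s) + 𝟙 (w <ᵇ suc h₁)         ≡⟨ cong (count Lᴱ (eastSteps s) +_) (𝟙-<ᵇ-suc w h₁) ⟩
    count Lᴱ (eastSteps s) + (𝟙 (w <ᵇ h₁) + 𝟙 (h₁ ≡ᵇ w)) ≡⟨ cong (count Lᴱ (eastSteps s) +_) (ℕ.+-comm (𝟙 (w <ᵇ h₁)) _) ⟩
    count Lᴱ (eastSteps s) + (𝟙 (h₁ ≡ᵇ w) + 𝟙 (w <ᵇ h₁)) ≡⟨ sym (ℕ.+-assoc (count Lᴱ (eastSteps s)) _ _) ⟩
    count Lᴱ (eastSteps s) + 𝟙 (h₁ ≡ᵇ w) + 𝟙 (w <ᵇ h₁) ≡⟨ cong (_+ 𝟙 (w <ᵇ h₁)) (sym (count-∷ʳ Lᴱ (eastSteps s) (end s))) ⟩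
    count Lᴱ (eastSteps s ∷ʳ end s) + 𝟙 (w <ᵇ h₁)   ∎
    where
    Lᴺ = λ q → level q ≡ᵇ w
    Lᴱ = λ e → level (step E e) ≡ᵇ w
    h₁ = level (step E (end s))

-- lexᵇ a t b decides a + pε < b + qε (or ≤), where t is the verdict on the ε-parts p, q.
lexᵇ : ℕ → Bool → ℕ → Bool
lexᵇ a t b = (a <ᵇ b) ∨ ((a ≡ᵇ b) ∧ t)

<ε-+ : ∀ a p b q → ((ℤ.+ a , ℤ.+ p) <ε (ℤ.+ b , ℤ.+ q)) ≡ lexᵇ a (p <ᵇ q) b
<ε-+ a p b q
  rewrite isYes≗does (ℤ.+ a ℤ.<? ℤ.+ b) | isYes≗does (ℤ.+ a ℤ.≟ ℤ.+ b) | isYes≗does (ℤ.+ p ℤ.<? ℤ.+ q) = refl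

≤ε-+ : ∀ a p b q → ((ℤ.+ a , ℤ.+ p) ≤ε (ℤ.+ b , ℤ.+ q)) ≡ lexᵇ a (p ≤ᵇ q) b
≤ε-+ a p b q
  rewrite isYes≗does (ℤ.+ a ℤ.<? ℤ.+ b) | isYes≗does (ℤ.+ a ℤ.≟ ℤ.+ b) | isYes≗does (ℤ.+ p ℤ.≤? ℤ.+ q) = refl

dist-weaklyAbove : ∀ {x y} → x ≤ y → dist (x , y) ≡ (ℤ.+ (y ∸ x) , ℤ.+ x)
dist-weaklyAbove {x} {y} x≤y =
  cong₂ _,_ (trans (ℤ.m-n≡m⊖n y x) (ℤ.⊖-≥ x≤y)) (cong (ℤ._+_ (ℤ.+ 0)) (ℤ.neg-involutive (ℤ.+ x)))

dist-<ε : ∀ {c d x y} → c ≤ d → x ≤ y → (dist (c , d) <ε dist (x , y)) ≡ lexᵇ (d ∸ c) (c <ᵇ x) (y ∸ x)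
dist-<ε {c} {d} {x} {y} c≤d x≤y =
  trans (cong₂ _<ε_ (dist-weaklyAbove c≤d) (dist-weaklyAbove x≤y)) (<ε-+ (d ∸ c) c (y ∸ x) x)

dist-≤ε : ∀ {c d x y} → c ≤ d → x ≤ y → (dist (c , d) ≤ε dist (x , y)) ≡ lexᵇ (d ∸ c) (c ≤ᵇ x) (y ∸ x)
dist-≤ε {c} {d} {x} {y} c≤d x≤y =
  trans (cong₂ _≤ε_ (dist-weaklyAbove c≤d) (dist-weaklyAbove x≤y)) (≤ε-+ (d ∸ c) c (y ∸ x) x)

<ᵇ-true : ∀ {m n} → m < n → (m <ᵇ n) ≡ true
<ᵇ-true {zero}  (s≤s _)   = refl
<ᵇ-true {suc m} (s≤s m<n) = <ᵇ-true m<n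

<ᵇ-false : ∀ {m n} → n ≤ m → (m <ᵇ n) ≡ false
<ᵇ-false z≤n       = refl
<ᵇ-false (s≤s n≤m) = <ᵇ-false n≤m

≤ᵇ-false : ∀ {m n} → n < m → (m ≤ᵇ n) ≡ false
≤ᵇ-false (s≤s n≤m) = <ᵇ-false n≤m

≡ᵇ-false : ∀ {m n} → m < n → (m ≡ᵇ n) ≡ false
≡ᵇ-false {zero}  (s≤s _)   = refl
≡ᵇ-false {suc m} (s≤s m<n) = ≡ᵇ-false m<n

lexᵇ-between-none : ∀ a b → lexᵇ a false b ∧ lexᵇ b false (suc a) ≡ false
lexᵇ-between-none zero    zero          = refl
lexᵇ-between-none zero    (suc zero)    = refl
lexᵇ-between-none zero    (suc (suc b)) = refl
lexᵇ-between-none (suc a) zero          = refl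
lexᵇ-between-none (suc a) (suc b)       = lexᵇ-between-none a b

lexᵇ-between-upper : ∀ a b → lexᵇ a false b ∧ lexᵇ b true (suc a) ≡ (b ≡ᵇ suc a)
lexᵇ-between-upper zero    zero          = refl
lexᵇ-between-upper zero    (suc zero)    = refl
lexᵇ-between-upper zero    (suc (suc b)) = refl
lexᵇ-between-upper (suc a) zero          = refl
lexᵇ-between-upper (suc a) (suc b)       = lexᵇ-between-upper a b

lexᵇ-between-lower : ∀ a b → lexᵇ b true a ∧ lexᵇ a false (suc b) ≡ (b ≡ᵇ a)
lexᵇ-between-lower zero          zero    = refl
lexᵇ-between-lower zero          (suc b) = refl
lexᵇ-between-lower (suc zero)    zero    = refl
lexᵇ-between-lower (suc (suc a)) zero    = refl
lexᵇ-between-lower (suc a)       (suc b) = lexᵇ-between-lower a b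

lexᵇ-between-two : ∀ w v → 𝟙 (lexᵇ w true (suc v) ∧ lexᵇ v false (suc w)) ≡ 𝟙 (w ≡ᵇ suc v) + 𝟙 (w ≡ᵇ v)
lexᵇ-between-two zero          zero          = refl
lexᵇ-between-two zero          (suc zero)    = refl
lexᵇ-between-two zero          (suc (suc v)) = refl
lexᵇ-between-two (suc zero)    zero          = refl
lexᵇ-between-two (suc (suc w)) zero          = refl
lexᵇ-between-two (suc w)       (suc v)       = lexᵇ-between-two w v

attacks-lexᵇ : ∀ {c d x y} → c ≤ d → x ≤ y →
  attacks ((c , d) , (x , y)) ≡ lexᵇ (d ∸ c) (c <ᵇ x) (y ∸ x) ∧ lexᵇ (y ∸ x) (x <ᵇ c) (suc (d ∸ c))
attacks-lexᵇ c≤d x≤y =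
  cong₂ _∧_ (dist-<ε c≤d x≤y) (trans (dist-<ε x≤y (ℕ.m≤n⇒m≤1+n c≤d)) (cong (lexᵇ _ _) (ℕ.+-∸-assoc 1 c≤d)))

attacks-≻ : ∀ {c d x y} → c ≤ d → x ≤ y → (x , y) ≺ (c , d) → attacks ((c , d) , (x , y)) ≡ (y ∸ x ≡ᵇ suc (d ∸ c))
attacks-≻ {c} {d} {x} {y} c≤d x≤y (inj₁ x<c)
  rewrite attacks-lexᵇ c≤d x≤y | <ᵇ-false (ℕ.<⇒≤ x<c) | <ᵇ-true x<c = lexᵇ-between-upper (d ∸ c) (y ∸ x)
attacks-≻ {c} {d} {_} {y} c≤d c≤y (inj₂ (refl , y<d))
  rewrite attacks-lexᵇ c≤d c≤y | <ᵇ-false (ℕ.≤-refl {c}) =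
  trans (lexᵇ-between-none (d ∸ c) (y ∸ c)) (sym (≡ᵇ-false (ℕ.m<n⇒m<1+n (ℕ.∸-monoˡ-< y<d c≤y))))

attacks-≺ : ∀ {c d x y} → c ≤ d → x ≤ y → (x , y) ≺ (c , d) → attacks ((x , y) , (c , d)) ≡ (y ∸ x ≡ᵇ d ∸ c)
attacks-≺ {c} {d} {x} {y} c≤d x≤y (inj₁ x<c)
  rewrite attacks-lexᵇ x≤y c≤d | <ᵇ-false (ℕ.<⇒≤ x<c) | <ᵇ-true x<c = lexᵇ-between-lower (d ∸ c) (y ∸ x)
attacks-≺ {c} {d} {_} {y} c≤d c≤y (inj₂ (refl , y<d))
  rewrite attacks-lexᵇ c≤y c≤d | <ᵇ-false (ℕ.≤-refl {c}) =
  trans (lexᵇ-between-none (y ∸ c) (d ∸ c)) (sym (≡ᵇ-false (ℕ.∸-monoˡ-< y<d c≤y)))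

dinvPair-left : ∀ {a b c d} → suc a ≤ b → c ≤ d → a < c →
  𝟙 (dinvPair ((a , b) , (c , d))) ≡ 𝟙 (b ∸ suc a ≡ᵇ suc (d ∸ c)) + 𝟙 (b ∸ suc a ≡ᵇ d ∸ c)
dinvPair-left {a} {b} {c} {d} a<b c≤d a<c = begin
  𝟙 (dinvPair ((a , b) , (c , d)))
    ≡⟨ cong (λ t → 𝟙 (t ∧ someLineMeets (a , b) (c , d))) (<ᵇ-true a<c) ⟩
  𝟙 ((dist (suc a , b) ≤ε dist (c , suc d)) ∧ (dist (c , d) ≤ε dist (a , b)))
    ≡⟨ cong₂ (λ l r → 𝟙 (l ∧ r)) (dist-≤ε a<b (ℕ.m≤n⇒m≤1+n c≤d)) (dist-≤ε c≤d (ℕ.<⇒≤ a<b)) ⟩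
  𝟙 (lexᵇ (b ∸ suc a) (suc a ≤ᵇ c) (suc d ∸ c) ∧ lexᵇ (d ∸ c) (c ≤ᵇ a) (b ∸ a))
    ≡⟨ cong₂ (λ l r → 𝟙 (l ∧ r)) (cong₂ (lexᵇ (b ∸ suc a)) (<ᵇ-true a<c) (ℕ.+-∸-assoc 1 c≤d))
                                  (cong₂ (lexᵇ (d ∸ c)) (≤ᵇ-false a<c) (ℕ.+-∸-assoc 1 a<b)) ⟩
  𝟙 (lexᵇ (b ∸ suc a) true (suc (d ∸ c)) ∧ lexᵇ (d ∸ c) false (suc (b ∸ suc a)))
    ≡⟨ lexᵇ-between-two (b ∸ suc a) (d ∸ c) ⟩
  𝟙 (b ∸ suc a ≡ᵇ suc (d ∸ c)) + 𝟙 (b ∸ suc a ≡ᵇ d ∸ c) ∎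

dinvPair-right : ∀ {a b c d} → c ≤ a → dinvPair ((a , b) , (c , d)) ≡ false
dinvPair-right {a} {b} {c} {d} c≤a = cong (_∧ someLineMeets (a , b) (c , d)) (<ᵇ-false c≤a)

attacks-irrefl : ∀ {c d} → c ≤ d → attacks ((c , d) , (c , d)) ≡ false
attacks-irrefl {c} {d} c≤d rewrite attacks-lexᵇ c≤d c≤d | <ᵇ-false (ℕ.≤-refl {c}) = lexᵇ-between-none (d ∸ c) (d ∸ c)

dinv-∷ʳE : ∀ s → Above s → dinv (s ∷ʳ E) ≡ dinv s
dinv-∷ʳE s above = begin
  dinv (s ∷ʳ E)
    ≡⟨ cong₂ (λ es ns → count dinvPair (pairs es ns)) (eastSteps-∷ʳE s) (northSteps-∷ʳE s) ⟩
  count dinvPair (pairs (eastSteps s ∷ʳ end s) (northSteps s))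
    ≡⟨ count-pairs-∷ʳˡ dinvPair (eastSteps s) (end s) (northSteps s) ⟩
  dinv s + count (λ q → dinvPair (end s , q)) (northSteps s)
    ≡⟨ cong (dinv s +_) (count-none (All.map (λ (_ , q≺end) → dinvPair-right (≺⇒≤ q≺end)) (northSteps-above-≺end s above))) ⟩
  dinv s + 0
    ≡⟨ ℕ.+-identityʳ (dinv s) ⟩
  dinv s ∎

dinv-∷ʳN : ∀ s → dinv (s ∷ʳ N) ≡ dinv s + count (λ e → dinvPair (e , end s)) (eastSteps s)
dinv-∷ʳN s =
  trans (cong₂ (λ es ns → count dinvPair (pairs es ns)) (eastSteps-∷ʳN s) (northSteps-∷ʳN s))
        (count-pairs-∷ʳʳ dinvPair (eastSteps s) (northSteps s) (end s))

maxtdinv-∷ʳN : ∀ s → Above s → maxtdinv (s ∷ʳ N) ≡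
  maxtdinv s + (count (λ q → attacks (end s , q)) (northSteps s) + count (λ q → attacks (q , end s)) (northSteps s))
maxtdinv-∷ʳN s above = begin
  maxtdinv (s ∷ʳ N)
    ≡⟨ cong (λ ns → count attacks (pairs ns ns)) (northSteps-∷ʳN s) ⟩
  count attacks (pairs (ns ∷ʳ f) (ns ∷ʳ f))
    ≡⟨ count-pairs-∷ʳˡ attacks ns f (ns ∷ʳ f) ⟩
  count attacks (pairs ns (ns ∷ʳ f)) + count (λ q → attacks (f , q)) (ns ∷ʳ f)
    ≡⟨ cong₂ _+_ (count-pairs-∷ʳʳ attacks ns ns f) (count-∷ʳ (λ q → attacks (f , q)) ns f) ⟩
  (maxtdinv s + into) + (outof + 𝟙 (attacks (f , f)))
    ≡⟨ cong (λ b → (maxtdinv s + into) + (outof + 𝟙 b)) (attacks-irrefl (Above-end s above)) ⟩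
  (maxtdinv s + into) + (outof + 0)
    ≡⟨ solve 3 (λ m b a → (m :+ b) :+ (a :+ con 0) := m :+ (a :+ b)) refl (maxtdinv s) into outof ⟩
  maxtdinv s + (outof + into) ∎
  where
  ns    = northSteps s
  f     = end s
  outof = count (λ q → attacks (f , q)) ns
  into  = count (λ q → attacks (q , f)) ns

count-dinvPair-end≡count-attacks-end : ∀ s → Above s →
  count (λ e → dinvPair (e , end s)) (eastSteps s) ≡
  count (λ q → attacks (end s , q)) (northSteps s) + count (λ q → attacks (q , end s)) (northSteps s)
count-dinvPair-end≡count-attacks-end s above = begin
  count (λ e → dinvPair (e , f)) es
    ≡⟨ count-split (All.map (λ (above-e , e-left) → dinvPair-left above-e above-f e-left) (eastSteps-above-left s above)) ⟩
  count (λ e → level (step E e) ≡ᵇ suc v) es + count (λ e → level (step E e) ≡ᵇ v) es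
    ≡⟨ sym (cong₂ _+_ (balance-above (suc v) (ℕ.n≤1+n v)) (balance-above v ℕ.≤-refl)) ⟩
  count (λ q → level q ≡ᵇ suc v) ns + count (λ q → level q ≡ᵇ v) ns
    ≡⟨ sym (cong₂ _+_ (count-cong (All.map (λ (above-q , q≺f) → attacks-≻ above-f above-q q≺f) facts))
                      (count-cong (All.map (λ (above-q , q≺f) → attacks-≺ above-f above-q q≺f) facts))) ⟩
  count (λ q → attacks (f , q)) ns + count (λ q → attacks (q , f)) ns ∎
  where
  es = eastSteps s
  ns = northSteps s
  f  = end s
  v  = level f
  above-f = Above-end s above
  facts = northSteps-above-≺end s above
  balance-above : ∀ w → v ≤ w →
    count (λ q → level q ≡ᵇ w) ns ≡ count (λ e → level (step E e) ≡ᵇ w) es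
  balance-above w v≤w =
    trans (north-east-balance s above w)
          (trans (cong (λ b → count (λ e → level (step E e) ≡ᵇ w) es + 𝟙 b) (<ᵇ-false v≤w)) (ℕ.+-identityʳ _))

dinv≡maxtdinv : ∀ s → Above s → dinv s ≡ maxtdinv s
dinv≡maxtdinv = ∷ʳ-induction _ (λ _ → refl) extend
  where
  extend : ∀ s t → (Above s → dinv s ≡ maxtdinv s) → Above (s ∷ʳ t) → dinv (s ∷ʳ t) ≡ maxtdinv (s ∷ʳ t)
  extend s t ih above with Above-∷ʳ⁻ s t above | t
  ... | above-s , _ | N = begin
    dinv (s ∷ʳ N)    ≡⟨ dinv-∷ʳN s ⟩
    dinv s + _       ≡⟨ cong₂ _+_ (ih above-s) (count-dinvPair-end≡count-attacks-end s above-s) ⟩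
    maxtdinv s + _   ≡⟨ sym (maxtdinv-∷ʳN s above-s) ⟩
    maxtdinv (s ∷ʳ N) ∎
  ... | above-s , _ | E = begin
    dinv (s ∷ʳ E)     ≡⟨ dinv-∷ʳE s above-s ⟩
    dinv s            ≡⟨ ih above-s ⟩
    maxtdinv s        ≡⟨ cong (λ ns → count attacks (pairs ns ns)) (sym (northSteps-∷ʳE s)) ⟩
    maxtdinv (s ∷ʳ E) ∎

proposition8p18 : (k : ℕ) (π : List Step) → IsDyck k π → dinv π ≡ maxtdinv π
proposition8p18 k π dyck = dinv≡maxtdinv π (IsDyck.above dyck)
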